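{- Fix integers $m\ge 2$ and $n\ge 1$. For $s,r\in[m]=\{1,\dots,m\}$ let $F_m^{(s\to r)}(n)$ denote the number of words of length $mn$ over $[m]$ that use each color exactly $n$ times, begin with $s$, end with $r$, and have no two consecutive equal letters. Let $S_m(n)$ be the number of words of length $mn$ over $[m]$ that use each color exactly $n$ times, have no two consecutive equal letters, and have distinct first and last letters. Then for all $s,r,s',r'\in[m]$ with $s\neq r$ and $s'\neq r'$, \[ F_m^{(s\to r)}(n)=F_m^{(s'\to r')}(n), \] and \[ S_m(n)=\sum_{\substack{s,r\in[m]\\ s\neq r}}F_m^{(s\to r)}(n)=m(m-1)\,F_m^{(1\to 2)}(n). \] -}

module Defs where

open import Data.Nat using (ℕ; zero; suc; _*_)
open import Data.Fin using (Fin)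
open import Data.Fin.Properties using (_≟_)
open import Data.List using (List; []; _∷_; map; concatMap; length; filter; allFin)
open import Data.List.Relation.Unary.All using (All)
open import Data.List.Relation.Unary.All using (all?) renaming ()
open import Data.Maybe using (Maybe; just; nothing)
open import Data.Product using (_×_; _,_)
open import Relation.Nullary using (Dec; yes; no; ¬_)
open import Relation.Nullary.Decidable using (_×-dec_; ¬?)
open import Relation.Binary.PropositionalEquality using (_≡_)
import Data.Nat.Properties as ℕP
open import Data.Nat.ListAction using (sum)
open import Data.Nat using (_≤_; _<_; s≤s; z≤n)
open import Data.Fin using (fromℕ<)

words : (m L : ℕ) → List (List (Fin m))
words m zero    = [] ∷ []
words m (suc L) = concatMap (λ c → map (c ∷_) (words m L)) (allFin m)

occ : ∀ {m} → Fin m → List (Fin m) → ℕ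
occ c w = length (filter (λ x → x ≟ c) w)

Balanced : ∀ {m} → ℕ → List (Fin m) → Set
Balanced {m} n w = All (λ c → occ c w ≡ n) (allFin m)

balanced? : ∀ {m} n (w : List (Fin m)) → Dec (Balanced n w)
balanced? {m} n w = all? (λ c → occ c w ℕP.≟ n) (allFin m)

data NoAdjEq {m} : List (Fin m) → Set where
  nil  : NoAdjEq []
  one  : ∀ x → NoAdjEq (x ∷ [])
  cons : ∀ {x y w} → ¬ x ≡ y → NoAdjEq (y ∷ w) → NoAdjEq (x ∷ y ∷ w)

noAdjEq? : ∀ {m} (w : List (Fin m)) → Dec (NoAdjEq w)
noAdjEq? [] = yes nil
noAdjEq? (x ∷ []) = yes (one x)
noAdjEq? (x ∷ y ∷ w) with x ≟ y | noAdjEq? (y ∷ w)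
... | yes e | _     = no λ { (cons ne _) → ne e }
... | no ne | yes p = yes (cons ne p)
... | no _  | no np = no λ { (cons _ p) → np p }

first : ∀ {m} → List (Fin m) → Maybe (Fin m)
first []      = nothing
first (x ∷ _) = just x

lastL : ∀ {m} → List (Fin m) → Maybe (Fin m)
lastL []          = nothing
lastL (x ∷ [])    = just x
lastL (_ ∷ y ∷ w) = lastL (y ∷ w)

maybeFin? : ∀ {m} (a b : Maybe (Fin m)) → Dec (a ≡ b)
maybeFin? nothing nothing = yes _≡_.refl
maybeFin? nothing (just _) = no λ ()
maybeFin? (just _) nothing = no λ ()
maybeFin? (just x) (just y) with x ≟ y
... | yes _≡_.refl = yes _≡_.refl
... | no ne = no λ { _≡_.refl → ne _≡_.refl }

IsF : ∀ {m} → ℕ → Fin m → Fin m → List (Fin m) → Set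
IsF n s r w = Balanced n w × NoAdjEq w × first w ≡ just s × lastL w ≡ just r

isF? : ∀ {m} n (s r : Fin m) (w : List (Fin m)) → Dec (IsF n s r w)
isF? n s r w = balanced? n w ×-dec noAdjEq? w ×-dec maybeFin? (first w) (just s) ×-dec maybeFin? (lastL w) (just r)

F : (m n : ℕ) → Fin m → Fin m → ℕ
F m n s r = length (filter (isF? n s r) (words m (m * n)))

IsS : ∀ {m} → ℕ → List (Fin m) → Set
IsS n w = Balanced n w × NoAdjEq w × ¬ (first w ≡ lastL w)

isS? : ∀ {m} n (w : List (Fin m)) → Dec (IsS n w)
isS? n w = balanced? n w ×-dec noAdjEq? w ×-dec ¬? (maybeFin? (first w) (lastL w))

S : (m n : ℕ) → ℕ
S m n = length (filter (isS? n) (words m (m * n)))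

sumF : (m n : ℕ) → ℕ
sumF m n = sum
  (concatMap (λ s → map (λ r → F m n s r) (filter (λ r → ¬? (s ≟ r)) (allFin m))) (allFin m))

-- Colors 1 and 2 of [m] (as elements 0 and 1 of Fin m), for m ≥ 2.
color1 : ∀ {m} → 2 ≤ m → Fin m
color1 {m} h = fromℕ< {0} {m} (ℕP.≤-trans (s≤s z≤n) h)

color2 : ∀ {m} → 2 ≤ m → Fin m
color2 {m} h = fromℕ< {1} {m} h

-- Relabelling the colours by a permutation of [m] is a bijection on balanced words
-- without equal neighbours that carries the endpoints (s, r) to their images; since
-- the symmetric group acts transitively on ordered pairs of distinct colours, all
-- the off-diagonal F(s → r) agree. A word counted by S has exactly one such pair of
-- endpoints, so S is the sum of F over the m(m − 1) off-diagonal pairs.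
module Submission where

open import Defs
open import Data.Nat using (ℕ; _*_; _∸_; _≤_; suc; zero; _+_; s≤s; z≤n)
import Data.Nat.Properties as ℕP
open import Data.Nat.ListAction using (sum)
open import Data.Nat.ListAction.Properties using (sum-++)
open import Data.Fin using (Fin; zero; suc)
open import Data.Fin.Properties using (_≟_; suc-injective)
open import Data.Fin.Permutation using (Permutation′; _⟨$⟩ʳ_; _⟨$⟩ˡ_; _∘ₚ_; inverseʳ)
import Data.Fin.Permutation as Perm
import Data.Fin.Permutation.Components as PC
open import Algebra.Properties.CommutativeMonoid.Sum ℕP.+-0-commutativeMonoid
  using (sum-permute; sum-cong-≗; sum-replicate-zero) renaming (sum to ∑)
open import Algebra.Properties.CommutativeSemigroup ℕP.+-commutativeSemigroup
  using (interchange)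
open import Data.List using (List; []; _∷_; map; concatMap; length; filter; allFin; tabulate)
open import Data.List.Properties using (map-∘; map-cong; map-cong-local; map-concatMap; length-tabulate)
open import Data.List.Relation.Unary.All as All using (All)
open import Data.List.Relation.Unary.All.Properties using (tabulate⁺; tabulate⁻; all-filter)
open import Data.Maybe as Maybe using (Maybe; just; nothing)
import Data.Maybe.Properties as Maybeₚ
open import Data.Maybe.Properties using (just-injective)
open import Data.Product using (_×_; Σ; ∃; _,_)
open import Function using (_∘_; id; _⇔_; mk⇔; Equivalence; Injection)
open import Function.Definitions using (Injective)
open import Function.Properties.Inverse using (↔⇒↣)
open import Relation.Nullary using (¬_; Dec; yes; no; contradiction)
open import Relation.Nullary.Decidable using (¬?)
open import Level using (0ℓ)
open import Relation.Unary using (Pred; Decidable)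
open import Relation.Binary.PropositionalEquality
  using (_≡_; _≢_; _≗_; refl; sym; trans; cong; cong₂; module ≡-Reasoning)

open ≡-Reasoning

private
  variable
    A B : Set
    k l m n : ℕ

indicator : Dec A → ℕ
indicator (yes _) = 1
indicator (no _)  = 0

indicator-yes : (d : Dec A) → A → indicator d ≡ 1
indicator-yes (yes _) _ = refl
indicator-yes (no ¬a) a = contradiction a ¬a

indicator-no : (d : Dec A) → ¬ A → indicator d ≡ 0
indicator-no (yes a) ¬a = contradiction a ¬a
indicator-no (no _)  _  = refl

indicator-cong : (d : Dec A) (e : Dec B) → A ⇔ B → indicator d ≡ indicator e
indicator-cong d (yes b) A⇔B = indicator-yes d (Equivalence.from A⇔B b)
indicator-cong d (no ¬b) A⇔B = indicator-no d (¬b ∘ Equivalence.to A⇔B)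

sumBy : (A → ℕ) → List A → ℕ
sumBy g xs = sum (map g xs)

sumBy-cong : {g h : A → ℕ} → g ≗ h → (xs : List A) → sumBy g xs ≡ sumBy h xs
sumBy-cong g≗h xs = cong sum (map-cong g≗h xs)

sumBy-cong-local : {g h : A → ℕ} {xs : List A} → All (λ x → g x ≡ h x) xs → sumBy g xs ≡ sumBy h xs
sumBy-cong-local eqs = cong sum (map-cong-local eqs)

sumBy-map : (g : B → ℕ) (f : A → B) (xs : List A) → sumBy g (map f xs) ≡ sumBy (g ∘ f) xs
sumBy-map g f xs = cong sum (sym (map-∘ xs))

sum-concatMap : (f : A → List ℕ) (xs : List A) → sum (concatMap f xs) ≡ sumBy (sum ∘ f) xs
sum-concatMap f []       = refl
sum-concatMap f (x ∷ xs) = trans (sum-++ (f x) (concatMap f xs)) (cong (sum (f x) +_) (sum-concatMap f xs))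

sumBy-concatMap : (g : B → ℕ) (f : A → List B) (xs : List A) →
                  sumBy g (concatMap f xs) ≡ sumBy (sumBy g ∘ f) xs
sumBy-concatMap g f xs = trans (cong sum (map-concatMap g f xs)) (sum-concatMap (map g ∘ f) xs)

sumBy-zero : {g : A → ℕ} → (∀ x → g x ≡ 0) → (xs : List A) → sumBy g xs ≡ 0
sumBy-zero g≡0 []       = refl
sumBy-zero g≡0 (x ∷ xs) = cong₂ _+_ (g≡0 x) (sumBy-zero g≡0 xs)

sumBy-const : (c : ℕ) (xs : List A) → sumBy (λ _ → c) xs ≡ length xs * c
sumBy-const c []       = refl
sumBy-const c (x ∷ xs) = cong (c +_) (sumBy-const c xs)

sumBy-+ : (g h : A → ℕ) (xs : List A) → sumBy (λ x → g x + h x) xs ≡ sumBy g xs + sumBy h xs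
sumBy-+ g h []       = refl
sumBy-+ g h (x ∷ xs) = trans (cong (g x + h x +_) (sumBy-+ g h xs)) (interchange (g x) (h x) _ _)

sumBy-comm : (h : A → B → ℕ) (xs : List A) (ys : List B) →
             sumBy (λ x → sumBy (h x) ys) xs ≡ sumBy (λ y → sumBy (λ x → h x y) xs) ys
sumBy-comm h []       ys = sym (sumBy-zero (λ _ → refl) ys)
sumBy-comm h (x ∷ xs) ys = begin
  sumBy (h x) ys + sumBy (λ x′ → sumBy (h x′) ys) xs      ≡⟨ cong (sumBy (h x) ys +_) (sumBy-comm h xs ys) ⟩
  sumBy (h x) ys + sumBy (λ y → sumBy (λ x′ → h x′ y) xs) ys ≡⟨ sumBy-+ (h x) _ ys ⟨
  sumBy (λ y → h x y + sumBy (λ x′ → h x′ y) xs) ys        ∎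

sumBy-filter : {P : Pred A 0ℓ} (P? : Decidable P) (g : A → ℕ) (xs : List A) →
               sumBy g (filter P? xs) ≡ sumBy (λ x → indicator (P? x) * g x) xs
sumBy-filter P? g []       = refl
sumBy-filter P? g (x ∷ xs) with P? x
... | yes _ = cong₂ _+_ (sym (ℕP.+-identityʳ (g x))) (sumBy-filter P? g xs)
... | no _  = sumBy-filter P? g xs

length-filter≡sumBy : {P : Pred A 0ℓ} (P? : Decidable P) (xs : List A) →
                      length (filter P? xs) ≡ sumBy (indicator ∘ P?) xs
length-filter≡sumBy P? []       = refl
length-filter≡sumBy P? (x ∷ xs) with P? x
... | yes _ = cong suc (length-filter≡sumBy P? xs)
... | no _  = length-filter≡sumBy P? xs

length-filter-∁ : {P : Pred A 0ℓ} (P? : Decidable P) (xs : List A) →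
                  length (filter P? xs) + length (filter (λ x → ¬? (P? x)) xs) ≡ length xs
length-filter-∁ P? []       = refl
length-filter-∁ P? (x ∷ xs) with P? x
... | yes _ = cong suc (length-filter-∁ P? xs)
... | no _  = trans (ℕP.+-suc _ _) (cong suc (length-filter-∁ P? xs))

∑-zero : (f : Fin m → ℕ) → (∀ i → f i ≡ 0) → ∑ f ≡ 0
∑-zero {m} f f≡0 = trans (sum-cong-≗ f≡0) (sum-replicate-zero m)

∑-δ : (f : Fin m → ℕ) (a : Fin m) → (∀ i → i ≢ a → f i ≡ 0) → ∑ f ≡ f a
∑-δ f zero    f≡0 = trans (cong (f zero +_) (∑-zero (f ∘ suc) (λ i → f≡0 (suc i) λ ()))) (ℕP.+-identityʳ _)
∑-δ f (suc a) f≡0 = trans (cong (_+ ∑ (f ∘ suc)) (f≡0 zero λ ()))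
                         (∑-δ (f ∘ suc) a (λ i i≢a → f≡0 (suc i) (i≢a ∘ suc-injective)))

sumBy-tabulate : (f : A → ℕ) (g : Fin m → A) → sumBy f (tabulate g) ≡ ∑ (f ∘ g)
sumBy-tabulate {m = zero}  f g = refl
sumBy-tabulate {m = suc m} f g = cong (f (g zero) +_) (sumBy-tabulate f (g ∘ suc))

sumBy-allFin : (f : Fin m → ℕ) → sumBy f (allFin m) ≡ ∑ f
sumBy-allFin f = sumBy-tabulate f id

sumBy-allFin-δ : (f : Fin m → ℕ) (a : Fin m) → (∀ i → i ≢ a → f i ≡ 0) → sumBy f (allFin m) ≡ f a
sumBy-allFin-δ f a f≡0 = trans (sumBy-allFin f) (∑-δ f a f≡0)

module _ {f : Fin k → Fin l} (f-injective : Injective _≡_ _≡_ f) where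

  occ-map : (c : Fin k) (w : List (Fin k)) → occ (f c) (map f w) ≡ occ c w
  occ-map c []      = refl
  occ-map c (x ∷ w) with f x ≟ f c | x ≟ c
  ... | yes _     | yes _    = cong suc (occ-map c w)
  ... | no _      | no _     = occ-map c w
  ... | yes fx≡fc | no x≢c   = contradiction (f-injective fx≡fc) x≢c
  ... | no fx≢fc  | yes refl = contradiction refl fx≢fc

  NoAdjEq-map⁺ : {w : List (Fin k)} → NoAdjEq w → NoAdjEq (map f w)
  NoAdjEq-map⁺ nil             = nil
  NoAdjEq-map⁺ (one x)         = one (f x)
  NoAdjEq-map⁺ (cons x≢y rest) = cons (x≢y ∘ f-injective) (NoAdjEq-map⁺ rest)

  just-map⇔ : {a : Fin k} (u : Maybe (Fin k)) → Maybe.map f u ≡ just (f a) ⇔ u ≡ just a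
  just-map⇔ u = mk⇔ (Maybeₚ.map-injective f-injective) (cong (Maybe.map f))

  first-map⇔ : {a : Fin k} (w : List (Fin k)) → first (map f w) ≡ just (f a) ⇔ first w ≡ just a
  first-map⇔ []      = just-map⇔ nothing
  first-map⇔ (x ∷ _) = just-map⇔ (just x)

  lastL-map⇔ : {a : Fin k} (w : List (Fin k)) → lastL (map f w) ≡ just (f a) ⇔ lastL w ≡ just a
  lastL-map⇔ []          = just-map⇔ nothing
  lastL-map⇔ (x ∷ [])    = just-map⇔ (just x)
  lastL-map⇔ (_ ∷ y ∷ w) = lastL-map⇔ (y ∷ w)

NoAdjEq-map⁻ : {f : Fin k → Fin l} (w : List (Fin k)) → NoAdjEq (map f w) → NoAdjEq w
NoAdjEq-map⁻ []          _                 = nil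
NoAdjEq-map⁻ (x ∷ [])    _                 = one x
NoAdjEq-map⁻ (x ∷ y ∷ w) (cons fx≢fy rest) = cons (fx≢fy ∘ cong _) (NoAdjEq-map⁻ (y ∷ w) rest)

module _ (π : Permutation′ m) where

  private
    σ : Fin m → Fin m
    σ = π ⟨$⟩ʳ_

  permutation-injective : Injective _≡_ _≡_ σ
  permutation-injective = Injection.injective (↔⇒↣ π)

  Balanced-relabel : (w : List (Fin m)) → Balanced n (map σ w) ⇔ Balanced n w
  Balanced-relabel {n = n} w = mk⇔
    (λ bal → tabulate⁺ λ c → trans (sym (occ-map permutation-injective c w)) (tabulate⁻ bal (σ c)))
    (λ bal → tabulate⁺ λ c → begin
      occ c (map σ w)              ≡⟨ cong (λ c′ → occ c′ (map σ w)) (inverseʳ π) ⟨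
      occ (σ (π ⟨$⟩ˡ c)) (map σ w) ≡⟨ occ-map permutation-injective (π ⟨$⟩ˡ c) w ⟩
      occ (π ⟨$⟩ˡ c) w             ≡⟨ tabulate⁻ bal (π ⟨$⟩ˡ c) ⟩
      n                            ∎)

  IsF-relabel : (s r : Fin m) (w : List (Fin m)) → IsF n (σ s) (σ r) (map σ w) ⇔ IsF n s r w
  IsF-relabel s r w = mk⇔
    (λ (bal , adj , fst , lst) → Equivalence.to (Balanced-relabel w) bal , NoAdjEq-map⁻ w adj
                               , Equivalence.to (first-map⇔ permutation-injective w) fst
                               , Equivalence.to (lastL-map⇔ permutation-injective w) lst)
    (λ (bal , adj , fst , lst) → Equivalence.from (Balanced-relabel w) bal , NoAdjEq-map⁺ permutation-injective adj
                               , Equivalence.from (first-map⇔ permutation-injective w) fst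
                               , Equivalence.from (lastL-map⇔ permutation-injective w) lst)

sumBy-words-suc : (g : List (Fin m) → ℕ) (L : ℕ) →
                  sumBy g (words m (suc L)) ≡ ∑ (λ c → sumBy (g ∘ (c ∷_)) (words m L))
sumBy-words-suc {m} g L = begin
  sumBy g (concatMap (λ c → map (c ∷_) (words m L)) (allFin m))
    ≡⟨ sumBy-concatMap g _ (allFin m) ⟩
  sumBy (λ c → sumBy g (map (c ∷_) (words m L))) (allFin m)
    ≡⟨ sumBy-cong (λ c → sumBy-map g (c ∷_) (words m L)) (allFin m) ⟩
  sumBy (λ c → sumBy (g ∘ (c ∷_)) (words m L)) (allFin m)
    ≡⟨ sumBy-allFin (λ c → sumBy (g ∘ (c ∷_)) (words m L)) ⟩
  ∑ (λ c → sumBy (g ∘ (c ∷_)) (words m L)) ∎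

sumBy-words-relabel : (π : Permutation′ m) (g : List (Fin m) → ℕ) (L : ℕ) →
                      sumBy g (words m L) ≡ sumBy (g ∘ map (π ⟨$⟩ʳ_)) (words m L)
sumBy-words-relabel π g zero    = refl
sumBy-words-relabel {m} π g (suc L) = begin
  sumBy g (words m (suc L))                                  ≡⟨ sumBy-words-suc g L ⟩
  ∑ (λ c → sumBy (g ∘ (c ∷_)) (words m L))                   ≡⟨ sum-permute _ π ⟩
  ∑ (λ c → sumBy (g ∘ (σ c ∷_)) (words m L))                 ≡⟨ sum-cong-≗ (λ c → sumBy-words-relabel π (g ∘ (σ c ∷_)) L) ⟩
  ∑ (λ c → sumBy (g ∘ (σ c ∷_) ∘ map σ) (words m L))         ≡⟨ sumBy-words-suc (g ∘ map σ) L ⟨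
  sumBy (g ∘ map σ) (words m (suc L))                        ∎
  where
    σ : Fin m → Fin m
    σ = π ⟨$⟩ʳ_

F-relabel : (π : Permutation′ m) (s r : Fin m) → F m n (π ⟨$⟩ʳ s) (π ⟨$⟩ʳ r) ≡ F m n s r
F-relabel {m} {n} π s r = begin
  length (filter (isF? n (σ s) (σ r)) W)                  ≡⟨ length-filter≡sumBy _ W ⟩
  sumBy (indicator ∘ isF? n (σ s) (σ r)) W                ≡⟨ sumBy-words-relabel π _ (m * n) ⟩
  sumBy (λ w → indicator (isF? n (σ s) (σ r) (map σ w))) W
    ≡⟨ sumBy-cong (λ w → indicator-cong _ _ (IsF-relabel π s r w)) W ⟩
  sumBy (indicator ∘ isF? n s r) W                        ≡⟨ length-filter≡sumBy _ W ⟨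
  length (filter (isF? n s r) W)                          ∎
  where
    σ : Fin m → Fin m
    σ = π ⟨$⟩ʳ_
    W : List (List (Fin m))
    W = words m (m * n)

transpose-i↦j : (i j : Fin m) → PC.transpose i j i ≡ j
transpose-i↦j i j with i ≟ i
... | yes _   = refl
... | no i≢i  = contradiction refl i≢i

transpose-fixes : {i j c : Fin m} → c ≢ i → c ≢ j → PC.transpose i j c ≡ c
transpose-fixes {i = i} {j} {c} c≢i c≢j with c ≟ i
... | yes c≡i = contradiction c≡i c≢i
... | no _ with c ≟ j
...   | yes c≡j = contradiction c≡j c≢j
...   | no _    = refl

-- Swap s with s′, then swap the image of r with r′; the second swap fixes s′.
permutation-2-transitive : {s r s′ r′ : Fin m} → s ≢ r → s′ ≢ r′ →
                           Σ (Permutation′ m) λ π → π ⟨$⟩ʳ s ≡ s′ × π ⟨$⟩ʳ r ≡ r′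
permutation-2-transitive {s = s} {r} {s′} {r′} s≢r s′≢r′ =
  τ ∘ₚ Perm.transpose r₁ r′ ,
  trans (cong (PC.transpose r₁ r′) (transpose-i↦j s s′)) (transpose-fixes s′≢r₁ s′≢r′) ,
  transpose-i↦j r₁ r′
  where
    τ = Perm.transpose s s′
    r₁ = τ ⟨$⟩ʳ r
    s′≢r₁ : s′ ≢ r₁
    s′≢r₁ s′≡r₁ = s≢r (permutation-injective τ (trans (transpose-i↦j s s′) s′≡r₁))

F-constant : (s r s′ r′ : Fin m) → s ≢ r → s′ ≢ r′ → F m n s r ≡ F m n s′ r′
F-constant {n = n} s r s′ r′ s≢r s′≢r′ with permutation-2-transitive s≢r s′≢r′
... | π , πs≡s′ , πr≡r′ = trans (sym (F-relabel π s r)) (cong₂ (λ a b → F _ n a b) πs≡s′ πr≡r′)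

allFinExcept : Fin m → List (Fin m)
allFinExcept {m} s = filter (λ r → ¬? (s ≟ r)) (allFin m)

length-filter-≟-allFin : (s : Fin m) → length (filter (s ≟_) (allFin m)) ≡ 1
length-filter-≟-allFin s = begin
  length (filter (s ≟_) (allFin _))      ≡⟨ length-filter≡sumBy (s ≟_) (allFin _) ⟩
  sumBy (indicator ∘ (s ≟_)) (allFin _)  ≡⟨ sumBy-allFin-δ _ s (λ r r≢s → indicator-no (s ≟ r) (r≢s ∘ sym)) ⟩
  indicator (s ≟ s)                      ≡⟨ indicator-yes (s ≟ s) refl ⟩
  1                                      ∎

length-allFinExcept : (s : Fin m) → length (allFinExcept s) ≡ m ∸ 1
length-allFinExcept {m} s = cong (_∸ 1) (begin
  1 + length (allFinExcept s)                                   ≡⟨ cong (_+ length (allFinExcept s)) (length-filter-≟-allFin s) ⟨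
  length (filter (s ≟_) (allFin m)) + length (allFinExcept s)  ≡⟨ length-filter-∁ (s ≟_) (allFin m) ⟩
  length (allFin m)                                             ≡⟨ length-tabulate id ⟩
  m                                                             ∎)

sumF-as-double-sum : (m n : ℕ) → sumF m n ≡ sumBy (λ s → sumBy (F m n s) (allFinExcept s)) (allFin m)
sumF-as-double-sum m n = sum-concatMap _ (allFin m)

lastL-∷ : (x : Fin m) (w : List (Fin m)) → ∃ λ b → lastL (x ∷ w) ≡ just b
lastL-∷ x []      = x , refl
lastL-∷ x (y ∷ w) = lastL-∷ y w

indicator-IsS : (w : List (Fin m)) →
  indicator (isS? n w) ≡ sumBy (λ s → sumBy (λ r → indicator (isF? n s r w)) (allFinExcept s)) (allFin m)
indicator-IsS {m} {n} [] = trans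
  (indicator-no (isS? n []) (λ (_ , _ , ends≢) → ends≢ refl))
  (sym (sumBy-zero (λ s → sumBy-zero (λ r → indicator-no (isF? n s r []) λ { (_ , _ , () , _) }) (allFinExcept s)) (allFin m)))
indicator-IsS {m} {n} (x ∷ w′) with lastL-∷ x w′
... | b , last≡b = sym (begin
  sumBy (λ s → sumBy (𝟙F s) (allFinExcept s)) (allFin m)
    ≡⟨ sumBy-allFin-δ _ x (λ s s≢x → sumBy-zero (λ r → indicator-no (isF? n s r w)
                                                   λ (_ , _ , fst , _) → s≢x (sym (just-injective fst))) (allFinExcept s)) ⟩
  sumBy (𝟙F x) (allFinExcept x)
    ≡⟨ sumBy-filter (λ r → ¬? (x ≟ r)) (𝟙F x) (allFin m) ⟩
  sumBy (λ r → indicator (¬? (x ≟ r)) * 𝟙F x r) (allFin m)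
    ≡⟨ sumBy-allFin-δ _ b (λ r r≢b → trans
         (cong (indicator (¬? (x ≟ r)) *_) (indicator-no (isF? n x r w)
           λ (_ , _ , _ , lst) → r≢b (just-injective (trans (sym lst) last≡b))))
         (ℕP.*-zeroʳ (indicator (¬? (x ≟ r))))) ⟩
  indicator (¬? (x ≟ b)) * 𝟙F x b
    ≡⟨ endpoints-distinct (x ≟ b) ⟩
  indicator (isS? n w) ∎)
  where
    w : List (Fin m)
    w = x ∷ w′
    𝟙F : Fin m → Fin m → ℕ
    𝟙F s r = indicator (isF? n s r w)
    endpoints-distinct : (d : Dec (x ≡ b)) → indicator (¬? d) * 𝟙F x b ≡ indicator (isS? n w)
    endpoints-distinct (yes x≡b) = sym (indicator-no (isS? n w)
      λ (_ , _ , ends≢) → ends≢ (trans (cong just x≡b) (sym last≡b)))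
    endpoints-distinct (no x≢b) = trans (ℕP.+-identityʳ _) (indicator-cong _ _ (mk⇔
      (λ (bal , adj , _ , _) → bal , adj , λ ends≡ → x≢b (just-injective (trans ends≡ last≡b)))
      (λ (bal , adj , _) → bal , adj , refl , last≡b)))

S≡sumF : (m n : ℕ) → S m n ≡ sumF m n
S≡sumF m n = begin
  length (filter (isS? n) W)
    ≡⟨ length-filter≡sumBy (isS? n) W ⟩
  sumBy (indicator ∘ isS? n) W
    ≡⟨ sumBy-cong indicator-IsS W ⟩
  sumBy (λ w → sumBy (λ s → sumBy (λ r → 𝟙F s r w) (allFinExcept s)) (allFin m)) W
    ≡⟨ sumBy-comm _ W (allFin m) ⟩
  sumBy (λ s → sumBy (λ w → sumBy (λ r → 𝟙F s r w) (allFinExcept s)) W) (allFin m)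
    ≡⟨ sumBy-cong (λ s → sumBy-comm (λ w r → 𝟙F s r w) W (allFinExcept s)) (allFin m) ⟩
  sumBy (λ s → sumBy (λ r → sumBy (𝟙F s r) W) (allFinExcept s)) (allFin m)
    ≡⟨ sumBy-cong (λ s → sumBy-cong (λ r → length-filter≡sumBy (isF? n s r) W) (allFinExcept s)) (allFin m) ⟨
  sumBy (λ s → sumBy (F m n s) (allFinExcept s)) (allFin m)
    ≡⟨ sumF-as-double-sum m n ⟨
  sumF m n ∎
  where
    W : List (List (Fin m))
    W = words m (m * n)
    𝟙F : Fin m → Fin m → List (Fin m) → ℕ
    𝟙F s r w = indicator (isF? n s r w)

sumF≡m*[m∸1]*F : (m n : ℕ) (c₁ c₂ : Fin m) → c₁ ≢ c₂ → sumF m n ≡ m * (m ∸ 1) * F m n c₁ c₂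
sumF≡m*[m∸1]*F m n c₁ c₂ c₁≢c₂ = begin
  sumF m n                                                  ≡⟨ sumF-as-double-sum m n ⟩
  sumBy (λ s → sumBy (F m n s) (allFinExcept s)) (allFin m) ≡⟨ sumBy-cong row-sum (allFin m) ⟩
  sumBy (λ _ → (m ∸ 1) * K) (allFin m)                      ≡⟨ sumBy-const _ (allFin m) ⟩
  length (allFin m) * ((m ∸ 1) * K)                         ≡⟨ cong (_* ((m ∸ 1) * K)) (length-tabulate {n = m} id) ⟩
  m * ((m ∸ 1) * K)                                         ≡⟨ ℕP.*-assoc m (m ∸ 1) K ⟨
  m * (m ∸ 1) * K                                           ∎
  where
    K : ℕ
    K = F m n c₁ c₂
    row-sum : (s : Fin m) → sumBy (F m n s) (allFinExcept s) ≡ (m ∸ 1) * K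
    row-sum s = begin
      sumBy (F m n s) (allFinExcept s)
        ≡⟨ sumBy-cong-local (All.map (λ s≢r → F-constant s _ c₁ c₂ s≢r c₁≢c₂) (all-filter _ (allFin m))) ⟩
      sumBy (λ _ → K) (allFinExcept s)   ≡⟨ sumBy-const K (allFinExcept s) ⟩
      length (allFinExcept s) * K        ≡⟨ cong (_* K) (length-allFinExcept s) ⟩
      (m ∸ 1) * K                        ∎

color1≢color2 : (2≤m : 2 ≤ m) → color1 2≤m ≢ color2 2≤m
color1≢color2 (s≤s (s≤s z≤n)) ()

mainTheorem3 : (m n : ℕ) → (2≤m : 2 ≤ m) → 1 ≤ n →
    ((s r s′ r′ : Fin m) → ¬ s ≡ r → ¬ s′ ≡ r′ → F m n s r ≡ F m n s′ r′)
    × (S m n ≡ sumF m n)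
    × (sumF m n ≡ m * (m ∸ 1) * F m n (color1 2≤m) (color2 2≤m))
mainTheorem3 m n 2≤m _ =
  F-constant , S≡sumF m n , sumF≡m*[m∸1]*F m n (color1 2≤m) (color2 2≤m) (color1≢color2 2≤m)
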